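{- Every canalyzing read-once Boolean function $f$ which is not linear read-once has a restriction that is a non-constant, non-canalyzing read-once function.
   Context: A Boolean function is read-once if it can be represented by a formula over conjunction, disjunction and negation in which each variable appears at most once. It is linear read-once (lro) if it is constant or representable by a nested formula: the literals $x,\overline{x}$ are nested formulas, and if $t$ is a nested formula not containing $x$ or $\overline{x}$ then $x\vee t$, $x\wedge t$, $\overline{x}\vee t$, $\overline{x}\wedge t$ are nested formulas. $f_{|x_i=\alpha}$ denotes the function obtained by fixing $x_i=\alpha$; $f$ is canalyzing if for some $i$, $f_{|x_i=0}$ or $f_{|x_i=1}$ is constant. A restriction of $f$ is a function obtained by fixing some of its variables to constants. -}

module Defs where

open import Data.Nat using (ℕ)
open import Data.Fin using (Fin; _≟_)
open import Data.Bool using (Bool; true; false; _∧_; _∨_; not; if_then_else_)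
open import Data.Maybe using (Maybe; just; nothing; fromMaybe)
open import Data.List using (List; []; _∷_; _++_; [_])
open import Data.List.Membership.Propositional using (_∉_)
open import Data.List.Relation.Unary.Unique.Propositional using (Unique)
open import Data.Product using (Σ; ∃; _×_; _,_)
open import Data.Sum using (_⊎_)
open import Relation.Nullary using (¬_; does)
open import Relation.Binary.PropositionalEquality using (_≡_)

BF : ℕ → Set
BF n = (Fin n → Bool) → Bool

Constant : ∀ {n} → BF n → Set
Constant f = Σ Bool λ c → ∀ x → f x ≡ c

_≗F_ : ∀ {n} → BF n → BF n → Set
f ≗F g = ∀ x → f x ≡ g x

setVar : ∀ {n} → Fin n → Bool → (Fin n → Bool) → (Fin n → Bool)
setVar i α x j = if does (i ≟ j) then α else x j

-- f_{|x_i = α}  (as a function of n variables, x_i becoming fictitious)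
fix : ∀ {n} → BF n → Fin n → Bool → BF n
fix f i α x = f (setVar i α x)

Canalyzing : ∀ {n} → BF n → Set
Canalyzing {n} f = Σ (Fin n) λ i → Σ Bool λ α → Constant (fix f i α)

-- Restrictions: a partial assignment ρ fixes variables j with ρ j = just b;
-- the remaining variables stay free (fixed ones become fictitious).
Restrict : ∀ {n} → (Fin n → Maybe Bool) → BF n → BF n
Restrict ρ f x = f (λ j → fromMaybe (x j) (ρ j))

data Formula (n : ℕ) : Set where
  var : Fin n → Formula n
  neg : Formula n → Formula n
  and : Formula n → Formula n → Formula n
  or  : Formula n → Formula n → Formula n

evalF : ∀ {n} → Formula n → (Fin n → Bool) → Bool
evalF (var i) x = x i
evalF (neg φ) x = not (evalF φ x)
evalF (and φ ψ) x = evalF φ x ∧ evalF ψ x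
evalF (or φ ψ) x = evalF φ x ∨ evalF ψ x

occ : ∀ {n} → Formula n → List (Fin n)
occ (var i) = [ i ]
occ (neg φ) = occ φ
occ (and φ ψ) = occ φ ++ occ ψ
occ (or φ ψ) = occ φ ++ occ ψ

ReadOnce : ∀ {n} → BF n → Set
ReadOnce {n} f = Constant f ⊎ Σ (Formula n) λ φ → Unique (occ φ) × (evalF φ ≗F f)

data Op : Set where
  opAnd opOr : Op

applyOp : Op → Bool → Bool → Bool
applyOp opAnd a b = a ∧ b
applyOp opOr a b = a ∨ b

lit : ∀ {n} → Fin n → Bool → (Fin n → Bool) → Bool
lit i true x = x i
lit i false x = not (x i)

data Nested (n : ℕ) : Set
nvars : ∀ {n} → Nested n → List (Fin n)

data Nested n where
  leaf : Fin n → Bool → Nested n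
  node : (i : Fin n) → Bool → Op → (t : Nested n) → i ∉ nvars t → Nested n

nvars (leaf i _) = [ i ]
nvars (node i _ _ t _) = i ∷ nvars t

evalN : ∀ {n} → Nested n → (Fin n → Bool) → Bool
evalN (leaf i b) x = lit i b x
evalN (node i b o t _) x = applyOp o (lit i b x) (evalN t x)

LRO : ∀ {n} → BF n → Set
LRO {n} f = Constant f ⊎ Σ (Nested n) λ t → evalN t ≗F f

-- Work bottom-up through a read-once formula: every subformula either computes
-- a nested (linear read-once) function of its own variables, or already has a
-- non-canalyzing read-once restriction.  Such a restriction of one conjunct
-- lifts to the conjunction by fixing the variables of the other conjunct so
-- that it is true; ¬ and ∨ reduce to ∧ by De Morgan.  Two nested formulas on
-- disjoint variables conjoin to a nested formula, except when both are rooted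
-- in ∨; then (l ∨ s) ∧ (l′ ∨ t) is itself non-canalyzing, since each disjunction
-- stays satisfiable with any one variable fixed and the other conjunct can
-- still be falsified.
module Submission where

open import Defs
open import Data.Nat using (ℕ)
open import Data.Fin using (Fin; _≟_)
open import Data.Bool using (Bool; true; false; _∧_; _∨_; not; if_then_else_)
open import Data.Bool.Properties
  using (∧-assoc; ∧-comm; ∧-idem; ∨-idem; ∧-zeroʳ; ∨-zeroʳ; not-involutive; not-¬; ∧-commutativeMonoid)
open import Algebra.Bundles using (CommutativeMonoid)
open import Algebra.Properties.CommutativeSemigroup
  (CommutativeMonoid.commutativeSemigroup ∧-commutativeMonoid) using (x∙yz≈y∙xz)
open import Data.Maybe using (Maybe; just; nothing; fromMaybe; _<∣>_)
open import Data.List using (List; []; _∷_; _++_; [_])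
open import Data.List.Membership.Propositional using (_∈_; _∉_)
open import Data.List.Membership.Propositional.Properties using (∈-++⁺ˡ; ∈-++⁺ʳ; ∈-++⁻)
open import Data.List.Relation.Unary.Any using (here; there)
open import Data.List.Relation.Unary.All using ([]; lookup)
open import Data.List.Relation.Unary.All.Properties using (¬Any⇒All¬; ++⁻ˡ)
open import Data.List.Relation.Unary.AllPairs using ([]; _∷_)
open import Data.List.Relation.Unary.Unique.Propositional using (Unique)
open import Data.List.Relation.Unary.Unique.Propositional.Properties using (++⁺)
open import Data.List.Relation.Binary.Disjoint.Propositional using (Disjoint; contractₗ; contractᵣ)
import Data.List.Relation.Binary.Disjoint.Propositional.Properties as Disjoint
open import Data.List.Relation.Binary.Subset.Propositional using (_⊆_)
open import Data.List.Relation.Binary.Subset.Propositional.Properties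
  using (⊆-refl; ⊆-trans; ∷⁺ʳ; ∈-∷⁺ʳ; xs⊆xs++ys; xs⊆x∷xs; ++⁺ʳ)
  renaming (++⁺ to ++⁺-⊆)
open import Data.Product using (Σ; _×_; _,_)
open import Data.Sum using (_⊎_; inj₁; inj₂; [_,_]′)
open import Data.Empty using (⊥-elim)
open import Relation.Nullary using (¬_; does; yes; no)
open import Relation.Binary.PropositionalEquality using (_≡_; refl; sym; trans; cong; cong₂; subst)

applyOp-idem : ∀ o b → applyOp o b b ≡ b
applyOp-idem opAnd = ∧-idem
applyOp-idem opOr = ∨-idem

not-∧-not : ∀ a b → not (not a ∧ not b) ≡ a ∨ b
not-∧-not true b = refl
not-∧-not false b = not-involutive b

fromMaybe-<∣> : ∀ {A : Set} (a : A) m s → fromMaybe (fromMaybe a m) s ≡ fromMaybe a (s <∣> m)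
fromMaybe-<∣> a m (just b) = refl
fromMaybe-<∣> a m nothing = refl

∉-++⁺ : ∀ {A : Set} {x : A} {xs ys} → x ∉ xs → x ∉ ys → x ∉ xs ++ ys
∉-++⁺ {xs = xs} x∉xs x∉ys x∈ = [ x∉xs , x∉ys ]′ (∈-++⁻ xs x∈)

∉⇒disjoint-[] : ∀ {A : Set} {x : A} {ys} → x ∉ ys → Disjoint [ x ] ys
∉⇒disjoint-[] x∉ys (here refl , x∈ys) = x∉ys x∈ys

unique-++⁻ˡ : ∀ {A : Set} (xs : List A) {ys} → Unique (xs ++ ys) → Unique xs
unique-++⁻ˡ [] u = []
unique-++⁻ˡ (x ∷ xs) (x∉ ∷ u) = ++⁻ˡ xs x∉ ∷ unique-++⁻ˡ xs u

unique-++⁻ʳ : ∀ {A : Set} (xs : List A) {ys} → Unique (xs ++ ys) → Unique ys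
unique-++⁻ʳ [] u = u
unique-++⁻ʳ (x ∷ xs) (_ ∷ u) = unique-++⁻ʳ xs u

unique-++⇒disjoint : ∀ {A : Set} (xs : List A) {ys} → Unique (xs ++ ys) → Disjoint xs ys
unique-++⇒disjoint (x ∷ xs) (x∉ ∷ u) (here refl , q) = lookup x∉ (∈-++⁺ʳ xs q) refl
unique-++⇒disjoint (x ∷ xs) (_ ∷ u) (there p , q) = unique-++⇒disjoint xs u (p , q)

module _ {n : ℕ} where

  open import Data.List.Membership.DecPropositional (_≟_ {n}) using (_∈?_)

  Assignment : Set
  Assignment = Fin n → Bool

  DependsOnly : List (Fin n) → BF n → Set
  DependsOnly vs g = ∀ x y → (∀ {j} → j ∈ vs → x j ≡ y j) → g x ≡ g y

  Extensional : BF n → Set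
  Extensional g = ∀ {x y : Assignment} → (∀ j → x j ≡ y j) → g x ≡ g y

  dependsOnly⇒extensional : ∀ {vs g} → DependsOnly vs g → Extensional g
  dependsOnly⇒extensional d {x} {y} x≗y = d x y (λ {j} _ → x≗y j)

  dependsOnly-lit : ∀ i b → DependsOnly [ i ] (lit i b)
  dependsOnly-lit i true x y agree = agree (here refl)
  dependsOnly-lit i false x y agree = cong not (agree (here refl))

  dependsOnly-not : ∀ {vs g} → DependsOnly vs g → DependsOnly vs (λ x → not (g x))
  dependsOnly-not d x y agree = cong not (d x y agree)

  dependsOnly-op : ∀ o {vs ws g h} → DependsOnly vs g → DependsOnly ws h →
                   DependsOnly (vs ++ ws) (λ x → applyOp o (g x) (h x))
  dependsOnly-op o {vs} dg dh x y agree =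
    cong₂ (applyOp o) (dg x y (λ p → agree (∈-++⁺ˡ p))) (dh x y (λ q → agree (∈-++⁺ʳ vs q)))

  fixOutside : List (Fin n) → Assignment → Fin n → Maybe Bool
  fixOutside vs z j = if does (j ∈? vs) then nothing else just (z j)

  -- x on vs and z elsewhere: the argument seen by Restrict (fixOutside vs z).
  splice : List (Fin n) → Assignment → Assignment → Assignment
  splice vs x z j = fromMaybe (x j) (fixOutside vs z j)

  splice-∈ : ∀ vs x z {j} → j ∈ vs → splice vs x z j ≡ x j
  splice-∈ vs x z {j} j∈ with j ∈? vs
  ... | yes _ = refl
  ... | no j∉ = ⊥-elim (j∉ j∈)

  splice-∉ : ∀ vs x z {j} → j ∉ vs → splice vs x z j ≡ z j
  splice-∉ vs x z {j} j∉ with j ∈? vs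
  ... | yes j∈ = ⊥-elim (j∉ j∈)
  ... | no _ = refl

  splice-agree : ∀ vs {x z k c} → x k ≡ c → z k ≡ c → splice vs x z k ≡ c
  splice-agree vs {k = k} xk zk with k ∈? vs
  ... | yes _ = xk
  ... | no _ = zk

  dependsOnly-spliceˡ : ∀ {vs g} → DependsOnly vs g → ∀ {x z} → g (splice vs x z) ≡ g x
  dependsOnly-spliceˡ {vs} d {x} {z} = d _ x (splice-∈ vs x z)

  dependsOnly-spliceʳ : ∀ {vs ws h} → DependsOnly ws h → Disjoint vs ws →
                        ∀ {x z} → h (splice vs x z) ≡ h z
  dependsOnly-spliceʳ {vs} d disj {x} {z} = d _ z (λ q → splice-∉ vs x z (λ p → disj (p , q)))

  setVar-self : ∀ {k α} {y : Assignment} → y k ≡ α → ∀ j → setVar k α y j ≡ y j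
  setVar-self {k} yk j with k ≟ j
  ... | yes refl = sym yk
  ... | no _ = refl

  Onto : BF n → Set
  Onto g = ∀ b → Σ Assignment λ z → g z ≡ b

  onto-lit : ∀ i b → Onto (lit i b)
  onto-lit i true c = (λ _ → c) , refl
  onto-lit i false c = (λ _ → not c) , not-involutive c

  onto-not : ∀ {g} → Onto g → Onto (λ x → not (g x))
  onto-not og b with og (not b)
  ... | z , gz = z , trans (cong not gz) (not-involutive b)

  onto-op : ∀ o {vs ws g h} → DependsOnly vs g → DependsOnly ws h → Disjoint vs ws →
            Onto g → Onto h → Onto (λ x → applyOp o (g x) (h x))
  onto-op o {vs} dg dh disj og oh b with og b | oh b
  ... | x , gx | z , hz =
    splice vs x z ,
    trans (cong₂ (applyOp o) (trans (dependsOnly-spliceˡ dg) gx) (trans (dependsOnly-spliceʳ dh disj) hz))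
          (applyOp-idem o b)

  onto⇒¬constant : ∀ {g} → Onto g → ¬ Constant g
  onto⇒¬constant og (c , const) with og (not c)
  ... | z , gz = not-¬ refl (trans (sym (const z)) gz)

  Attains : BF n → Fin n → Bool → Bool → Set
  Attains g k α b = Σ Assignment λ y → y k ≡ α × g y ≡ b

  TrueUnderAnyFix : BF n → Set
  TrueUnderAnyFix g = ∀ k α → Attains g k α true

  attains⇒¬canalyzing : ∀ {g} → Extensional g → (∀ k α b → Attains g k α b) → ¬ Canalyzing g
  attains⇒¬canalyzing ext att (k , α , c , const) with att k α (not c)
  ... | y , yk , gy = not-¬ refl (trans (sym (const y)) (trans (ext (setVar-self yk)) gy))

  attains-outside : ∀ {vs g k} → DependsOnly vs g → k ∉ vs → Onto g → ∀ α b → Attains g k α b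
  attains-outside {vs} dg k∉ og α b with og b
  ... | z , gz = splice vs z (λ _ → α) , splice-∉ vs z _ k∉ , trans (dependsOnly-spliceˡ dg) gz

  attains-either : ∀ {vs ws g h} → DependsOnly vs g → DependsOnly ws h → Disjoint vs ws →
                   Onto g → Onto h → ∀ k α b → Attains g k α b ⊎ Attains h k α b
  attains-either {vs} dg dh disj og oh k α b with k ∈? vs
  ... | yes k∈ = inj₂ (attains-outside dh (λ k∈ws → disj (k∈ , k∈ws)) oh α b)
  ... | no k∉ = inj₁ (attains-outside dg k∉ og α b)

  attains-both : ∀ {vs ws g h k α a b} → DependsOnly vs g → DependsOnly ws h → Disjoint vs ws →
                 Attains g k α a → Attains h k α b → Σ Assignment λ y → y k ≡ α × g y ≡ a × h y ≡ b
  attains-both {vs} dg dh disj (x , xk , gx) (z , zk , hz) =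
    splice vs x z , splice-agree vs {x} {z} xk zk ,
    trans (dependsOnly-spliceˡ dg) gx , trans (dependsOnly-spliceʳ dh disj) hz

  trueUnderAnyFix-∨ : ∀ {vs ws g h} → DependsOnly vs g → DependsOnly ws h → Disjoint vs ws →
                      Onto g → Onto h → TrueUnderAnyFix (λ x → g x ∨ h x)
  trueUnderAnyFix-∨ {g = g} dg dh disj og oh k α with attains-either dg dh disj og oh k α true
  ... | inj₁ (y , yk , gy) = y , yk , cong (_∨ _) gy
  ... | inj₂ (y , yk , hy) = y , yk , trans (cong (g y ∨_) hy) (∨-zeroʳ (g y))

  attains-∧ : ∀ {vs ws g h} → DependsOnly vs g → DependsOnly ws h → Disjoint vs ws →
              Onto g → Onto h → TrueUnderAnyFix g → TrueUnderAnyFix h →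
              ∀ k α b → Attains (λ x → g x ∧ h x) k α b
  attains-∧ dg dh disj og oh tg th k α true with attains-both dg dh disj (tg k α) (th k α)
  ... | y , yk , gy , hy = y , yk , cong₂ _∧_ gy hy
  attains-∧ {g = g} dg dh disj og oh tg th k α false with attains-either dg dh disj og oh k α false
  ... | inj₁ (y , yk , gy) = y , yk , cong (_∧ _) gy
  ... | inj₂ (y , yk , hy) = y , yk , trans (cong (g y ∧_) hy) (∧-zeroʳ (g y))

  NCRO : BF n → Set
  NCRO h = ReadOnce h × ¬ Constant h × ¬ Canalyzing h

  HasNCRORestriction : BF n → Set
  HasNCRORestriction g = Σ (Fin n → Maybe Bool) λ ρ → NCRO (Restrict ρ g)

  readOnce-resp : ∀ {f g : BF n} → f ≗F g → ReadOnce f → ReadOnce g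
  readOnce-resp f≗g (inj₁ (c , const)) = inj₁ (c , λ x → trans (sym (f≗g x)) (const x))
  readOnce-resp f≗g (inj₂ (φ , u , φ≗f)) = inj₂ (φ , u , λ x → trans (φ≗f x) (f≗g x))

  constant-resp : ∀ {f g : BF n} → f ≗F g → Constant f → Constant g
  constant-resp f≗g (c , const) = c , λ x → trans (sym (f≗g x)) (const x)

  canalyzing-resp : ∀ {f g : BF n} → f ≗F g → Canalyzing f → Canalyzing g
  canalyzing-resp f≗g (i , α , const) = i , α , constant-resp (λ x → f≗g (setVar i α x)) const

  ncro-resp : ∀ {f g : BF n} → f ≗F g → NCRO f → NCRO g
  ncro-resp f≗g (ro , ¬const , ¬can) =
    readOnce-resp f≗g ro ,
    (λ const → ¬const (constant-resp (λ x → sym (f≗g x)) const)) ,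
    (λ can → ¬can (canalyzing-resp (λ x → sym (f≗g x)) can))

  hasNCRORestriction-resp : ∀ {f g : BF n} → f ≗F g → HasNCRORestriction f → HasNCRORestriction g
  hasNCRORestriction-resp f≗g (ρ , r) = ρ , ncro-resp (λ x → f≗g _) r

  ncro-not : ∀ {h : BF n} → NCRO h → NCRO (λ x → not (h x))
  ncro-not {h} (ro , ¬const , ¬can) =
    readOnce-not ro , (λ c → ¬const (unnegate-constant c)) , (λ c → ¬can (unnegate-canalyzing c))
    where
    readOnce-not : ReadOnce h → ReadOnce (λ x → not (h x))
    readOnce-not (inj₁ (c , const)) = inj₁ (not c , λ x → cong not (const x))
    readOnce-not (inj₂ (φ , u , φ≗h)) = inj₂ (neg φ , u , λ x → cong not (φ≗h x))
    not-not : ∀ x → not (not (h x)) ≡ h x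
    not-not x = not-involutive (h x)
    unnegate-constant : Constant (λ x → not (h x)) → Constant h
    unnegate-constant (c , const) = constant-resp not-not (not c , λ x → cong not (const x))
    unnegate-canalyzing : Canalyzing (λ x → not (h x)) → Canalyzing h
    unnegate-canalyzing (i , α , c , const) =
      i , α , constant-resp (λ x → not-not (setVar i α x)) (not c , λ x → cong not (const x))

  hasNCRORestriction-not : ∀ {g} → HasNCRORestriction g → HasNCRORestriction (λ x → not (g x))
  hasNCRORestriction-not (ρ , r) = ρ , ncro-not r

  hasNCRORestriction-restrict : ∀ {F} σ → Extensional F →
                                HasNCRORestriction (Restrict σ F) → HasNCRORestriction F
  hasNCRORestriction-restrict σ ext (ρ , r) =
    (λ j → σ j <∣> ρ j) , ncro-resp (λ x → ext (λ j → fromMaybe-<∣> (x j) (ρ j) (σ j))) r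

  -- Fixing the variables outside ws so that g is true leaves h as a restriction of g ∧ h.
  hasNCRORestriction-∧ : ∀ {vs ws g h} → DependsOnly vs g → DependsOnly ws h → Disjoint vs ws →
                         Σ Assignment (λ z → g z ≡ true) →
                         HasNCRORestriction h → HasNCRORestriction (λ x → g x ∧ h x)
  hasNCRORestriction-∧ {ws = ws} {g} {h} dg dh disj (z , gz) r =
    hasNCRORestriction-restrict (fixOutside ws z) (dependsOnly⇒extensional (dependsOnly-op opAnd dg dh))
      (hasNCRORestriction-resp h≗ r)
    where
    h≗ : ∀ x → h x ≡ g (splice ws x z) ∧ h (splice ws x z)
    h≗ x = sym (cong₂ _∧_ (trans (dependsOnly-spliceʳ dg (Disjoint.sym disj)) gz) (dependsOnly-spliceˡ dh))

  dual : Op → Op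
  dual opAnd = opOr
  dual opOr = opAnd

  applyOp-dual : ∀ o a b → applyOp (dual o) (not a) (not b) ≡ not (applyOp o a b)
  applyOp-dual opAnd true b = refl
  applyOp-dual opAnd false b = refl
  applyOp-dual opOr true b = refl
  applyOp-dual opOr false b = refl

  lit-not : ∀ i b (x : Assignment) → lit i (not b) x ≡ not (lit i b x)
  lit-not i true x = refl
  lit-not i false x = sym (not-involutive (x i))

  negN : Nested n → Nested n
  nvars-negN : ∀ t → nvars (negN t) ≡ nvars t
  negN (leaf i b) = leaf i (not b)
  negN (node i b o t i∉) = node i (not b) (dual o) (negN t) (subst (i ∉_) (sym (nvars-negN t)) i∉)
  nvars-negN (leaf i b) = refl
  nvars-negN (node i b o t _) = cong (i ∷_) (nvars-negN t)

  evalN-negN : ∀ t x → evalN (negN t) x ≡ not (evalN t x)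
  evalN-negN (leaf i b) x = lit-not i b x
  evalN-negN (node i b o t _) x =
    trans (cong₂ (applyOp (dual o)) (lit-not i b x) (evalN-negN t x)) (applyOp-dual o _ _)

  dependsOnly-evalN : ∀ t → DependsOnly (nvars t) (evalN t)
  dependsOnly-evalN (leaf i b) = dependsOnly-lit i b
  dependsOnly-evalN (node i b o t _) = dependsOnly-op o (dependsOnly-lit i b) (dependsOnly-evalN t)

  onto-evalN : ∀ t → Onto (evalN t)
  onto-evalN (leaf i b) = onto-lit i b
  onto-evalN (node i b o t i∉) =
    onto-op o (dependsOnly-lit i b) (dependsOnly-evalN t) (∉⇒disjoint-[] i∉) (onto-lit i b) (onto-evalN t)

  trueUnderAnyFix-orRooted : ∀ i b t i∉ → TrueUnderAnyFix (evalN (node i b opOr t i∉))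
  trueUnderAnyFix-orRooted i b t i∉ =
    trueUnderAnyFix-∨ (dependsOnly-lit i b) (dependsOnly-evalN t) (∉⇒disjoint-[] i∉) (onto-lit i b) (onto-evalN t)

  unique-nvars : ∀ (t : Nested n) → Unique (nvars t)
  unique-nvars (leaf i b) = [] ∷ []
  unique-nvars (node i b o t i∉) = ¬Any⇒All¬ (nvars t) i∉ ∷ unique-nvars t

  litF : Fin n → Bool → Formula n
  litF i true = var i
  litF i false = neg (var i)

  opF : Op → Formula n → Formula n → Formula n
  opF opAnd = and
  opF opOr = or

  toFormula : Nested n → Formula n
  toFormula (leaf i b) = litF i b
  toFormula (node i b o t _) = opF o (litF i b) (toFormula t)

  occ-litF : ∀ i b → occ (litF i b) ≡ [ i ]
  occ-litF i true = refl
  occ-litF i false = refl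

  occ-opF : ∀ o φ ψ → occ (opF o φ ψ) ≡ occ φ ++ occ ψ
  occ-opF opAnd φ ψ = refl
  occ-opF opOr φ ψ = refl

  occ-toFormula : ∀ t → occ (toFormula t) ≡ nvars t
  occ-toFormula (leaf i b) = occ-litF i b
  occ-toFormula (node i b o t _) = trans (occ-opF o _ _) (cong₂ _++_ (occ-litF i b) (occ-toFormula t))

  evalF-litF : ∀ i b x → evalF (litF i b) x ≡ lit i b x
  evalF-litF i true x = refl
  evalF-litF i false x = refl

  evalF-opF : ∀ o φ ψ x → evalF (opF o φ ψ) x ≡ applyOp o (evalF φ x) (evalF ψ x)
  evalF-opF opAnd φ ψ x = refl
  evalF-opF opOr φ ψ x = refl

  evalF-toFormula : ∀ t x → evalF (toFormula t) x ≡ evalN t x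
  evalF-toFormula (leaf i b) x = evalF-litF i b x
  evalF-toFormula (node i b o t _) x =
    trans (evalF-opF o _ _ x) (cong₂ (applyOp o) (evalF-litF i b x) (evalF-toFormula t x))

  readOnce-nested-∧ : ∀ t u → Disjoint (nvars t) (nvars u) → ReadOnce (λ x → evalN t x ∧ evalN u x)
  readOnce-nested-∧ t u disj =
    inj₂ (and (toFormula t) (toFormula u) ,
          subst Unique (sym (cong₂ _++_ (occ-toFormula t) (occ-toFormula u)))
                (++⁺ (unique-nvars t) (unique-nvars u) disj) ,
          λ x → cong₂ _∧_ (evalF-toFormula t x) (evalF-toFormula u x))

  ncro-nested-∧ : ∀ t u → Disjoint (nvars t) (nvars u) →
                  TrueUnderAnyFix (evalN t) → TrueUnderAnyFix (evalN u) →
                  NCRO (λ x → evalN t x ∧ evalN u x)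
  ncro-nested-∧ t u disj tt tu =
    readOnce-nested-∧ t u disj ,
    onto⇒¬constant (onto-op opAnd dt du disj (onto-evalN t) (onto-evalN u)) ,
    attains⇒¬canalyzing (dependsOnly⇒extensional (dependsOnly-op opAnd dt du))
      (attains-∧ dt du disj (onto-evalN t) (onto-evalN u) tt tu)
    where
    dt = dependsOnly-evalN t
    du = dependsOnly-evalN u

  NestedOn : List (Fin n) → BF n → Set
  NestedOn vs g = Σ (Nested n) λ t → evalN t ≗F g × nvars t ⊆ vs

  Dichotomy : List (Fin n) → BF n → Set
  Dichotomy vs g = NestedOn vs g ⊎ HasNCRORestriction g

  dichotomy-resp : ∀ {vs ws f g} → f ≗F g → vs ⊆ ws → Dichotomy vs f → Dichotomy ws g
  dichotomy-resp f≗g vs⊆ws (inj₁ (t , t≗f , t⊆vs)) = inj₁ (t , (λ x → trans (t≗f x) (f≗g x)) , ⊆-trans t⊆vs vs⊆ws)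
  dichotomy-resp f≗g vs⊆ws (inj₂ r) = inj₂ (hasNCRORestriction-resp f≗g r)

  dichotomy-not : ∀ {vs g} → Dichotomy vs g → Dichotomy vs (λ x → not (g x))
  dichotomy-not (inj₁ (t , t≗g , t⊆vs)) =
    inj₁ (negN t , (λ x → trans (evalN-negN t x) (cong not (t≗g x))) , subst (_⊆ _) (sym (nvars-negN t)) t⊆vs)
  dichotomy-not {g = g} (inj₂ r) = inj₂ (hasNCRORestriction-not {g} r)

  dependsOnly-nested-∧ : ∀ t u → DependsOnly (nvars t ++ nvars u) (λ x → evalN t x ∧ evalN u x)
  dependsOnly-nested-∧ t u = dependsOnly-op opAnd (dependsOnly-evalN t) (dependsOnly-evalN u)

  dichotomy-lit-∧ : ∀ {vs g} i b → DependsOnly vs g → i ∉ vs →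
                    Dichotomy vs g → Dichotomy (i ∷ vs) (λ x → lit i b x ∧ g x)
  dichotomy-lit-∧ i b dg i∉ (inj₁ (t , t≗g , t⊆vs)) =
    inj₁ (node i b opAnd t (λ i∈t → i∉ (t⊆vs i∈t)) , (λ x → cong (lit i b x ∧_) (t≗g x)) , ∷⁺ʳ i t⊆vs)
  dichotomy-lit-∧ i b dg i∉ (inj₂ r) =
    inj₂ (hasNCRORestriction-∧ (dependsOnly-lit i b) dg (∉⇒disjoint-[] i∉) (onto-lit i b true) r)

  dichotomy-evalN : ∀ t → Dichotomy (nvars t) (evalN t)
  dichotomy-evalN t = inj₁ (t , (λ _ → refl) , ⊆-refl)

  -- Peel the ∧-literals off both formulas; only two ∨-rooted remainders fail to conjoin.
  nested-∧ : ∀ t u → Disjoint (nvars t) (nvars u) →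
             Dichotomy (nvars t ++ nvars u) (λ x → evalN t x ∧ evalN u x)
  nested-∧ (leaf i b) u disj =
    dichotomy-lit-∧ i b (dependsOnly-evalN u) (λ i∈u → disj (here refl , i∈u)) (dichotomy-evalN u)
  nested-∧ (node i b opAnd t i∉t) u disj =
    dichotomy-resp (λ x → sym (∧-assoc (lit i b x) (evalN t x) (evalN u x))) ⊆-refl
      (dichotomy-lit-∧ i b (dependsOnly-nested-∧ t u) (∉-++⁺ i∉t (λ i∈u → disj (here refl , i∈u)))
        (nested-∧ t u (contractₗ disj)))
  nested-∧ t@(node _ _ opOr _ _) (leaf j c) disj =
    dichotomy-resp (λ x → ∧-comm (lit j c x) (evalN t x)) (∈-∷⁺ʳ j∈ (xs⊆xs++ys (nvars t) [ j ]))
      (dichotomy-lit-∧ j c (dependsOnly-evalN t) (λ j∈t → disj (j∈t , here refl)) (dichotomy-evalN t))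
    where j∈ = ∈-++⁺ʳ (nvars t) (here refl)
  nested-∧ t@(node _ _ opOr _ _) (node j c opAnd u j∉u) disj =
    dichotomy-resp (λ x → x∙yz≈y∙xz (lit j c x) (evalN t x) (evalN u x))
      (∈-∷⁺ʳ j∈ (++⁺ʳ (nvars t) (xs⊆x∷xs (nvars u) j)))
      (dichotomy-lit-∧ j c (dependsOnly-nested-∧ t u) (∉-++⁺ (λ j∈t → disj (j∈t , here refl)) j∉u)
        (nested-∧ t u (contractᵣ disj)))
    where j∈ = ∈-++⁺ʳ (nvars t) (here refl)
  nested-∧ t@(node i b opOr s i∉) u@(node j c opOr v j∉) disj =
    inj₂ ((λ _ → nothing) ,
          ncro-nested-∧ t u disj (trueUnderAnyFix-orRooted i b s i∉) (trueUnderAnyFix-orRooted j c v j∉))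

  dichotomy-∧ : ∀ {vs ws g h} → DependsOnly vs g → DependsOnly ws h → Disjoint vs ws → Onto g → Onto h →
                Dichotomy vs g → Dichotomy ws h → Dichotomy (vs ++ ws) (λ x → g x ∧ h x)
  dichotomy-∧ {g = g} {h} dg dh disj og oh (inj₂ r) _ =
    inj₂ (hasNCRORestriction-resp (λ x → ∧-comm (h x) (g x)) (hasNCRORestriction-∧ dh dg (Disjoint.sym disj) (oh true) r))
  dichotomy-∧ dg dh disj og oh (inj₁ _) (inj₂ r) = inj₂ (hasNCRORestriction-∧ dg dh disj (og true) r)
  dichotomy-∧ _ _ disj _ _ (inj₁ (t , t≗g , t⊆vs)) (inj₁ (u , u≗h , u⊆ws)) =
    dichotomy-resp (λ x → cong₂ _∧_ (t≗g x) (u≗h x)) (++⁺-⊆ t⊆vs u⊆ws)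
      (nested-∧ t u (λ (p , q) → disj (t⊆vs p , u⊆ws q)))

  dependsOnly-evalF : ∀ φ → DependsOnly (occ φ) (evalF φ)
  dependsOnly-evalF (var i) = dependsOnly-lit i true
  dependsOnly-evalF (neg φ) = dependsOnly-not (dependsOnly-evalF φ)
  dependsOnly-evalF (and φ ψ) = dependsOnly-op opAnd (dependsOnly-evalF φ) (dependsOnly-evalF ψ)
  dependsOnly-evalF (or φ ψ) = dependsOnly-op opOr (dependsOnly-evalF φ) (dependsOnly-evalF ψ)

  onto-evalF : ∀ φ → Unique (occ φ) → Onto (evalF φ)
  onto-evalF (var i) _ = onto-lit i true
  onto-evalF (neg φ) u = onto-not (onto-evalF φ u)
  onto-evalF (and φ ψ) u =
    onto-op opAnd (dependsOnly-evalF φ) (dependsOnly-evalF ψ) (unique-++⇒disjoint (occ φ) u)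
      (onto-evalF φ (unique-++⁻ˡ (occ φ) u)) (onto-evalF ψ (unique-++⁻ʳ (occ φ) u))
  onto-evalF (or φ ψ) u =
    onto-op opOr (dependsOnly-evalF φ) (dependsOnly-evalF ψ) (unique-++⇒disjoint (occ φ) u)
      (onto-evalF φ (unique-++⁻ˡ (occ φ) u)) (onto-evalF ψ (unique-++⁻ʳ (occ φ) u))

  dichotomy-evalF : ∀ φ → Unique (occ φ) → Dichotomy (occ φ) (evalF φ)
  dichotomy-evalF (var i) _ = inj₁ (leaf i true , (λ _ → refl) , ⊆-refl)
  dichotomy-evalF (neg φ) u = dichotomy-not (dichotomy-evalF φ u)
  dichotomy-evalF (and φ ψ) u =
    dichotomy-∧ (dependsOnly-evalF φ) (dependsOnly-evalF ψ) (unique-++⇒disjoint (occ φ) u)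
      (onto-evalF φ uφ) (onto-evalF ψ uψ) (dichotomy-evalF φ uφ) (dichotomy-evalF ψ uψ)
    where
    uφ = unique-++⁻ˡ (occ φ) u
    uψ = unique-++⁻ʳ (occ φ) u
  dichotomy-evalF (or φ ψ) u =
    dichotomy-resp (λ x → not-∧-not (evalF φ x) (evalF ψ x)) ⊆-refl
      (dichotomy-not
        (dichotomy-∧ (dependsOnly-not (dependsOnly-evalF φ)) (dependsOnly-not (dependsOnly-evalF ψ))
          (unique-++⇒disjoint (occ φ) u) (onto-not (onto-evalF φ uφ)) (onto-not (onto-evalF ψ uψ))
          (dichotomy-not (dichotomy-evalF φ uφ)) (dichotomy-not (dichotomy-evalF ψ uψ))))
    where
    uφ = unique-++⁻ˡ (occ φ) u
    uψ = unique-++⁻ʳ (occ φ) u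

lemma7 : (n : ℕ) (f : BF n) → ReadOnce f → Canalyzing f → ¬ LRO f →
    Σ (Fin n → Maybe Bool) λ ρ →
      ReadOnce (Restrict ρ f) × ¬ Constant (Restrict ρ f) × ¬ Canalyzing (Restrict ρ f)
lemma7 n f (inj₁ const) _ ¬lro = ⊥-elim (¬lro (inj₁ const))
lemma7 n f (inj₂ (φ , u , φ≗f)) _ ¬lro with dichotomy-evalF φ u
... | inj₁ (t , t≗φ , _) = ⊥-elim (¬lro (inj₂ (t , λ x → trans (t≗φ x) (φ≗f x))))
... | inj₂ r = hasNCRORestriction-resp φ≗f r
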